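{- Let $p$ be a prime, $\ell\ge1$, and let $[c]$ be a non-zero constant sequence in $P_{p^\ell}$ with $t=\nu_p(c)$. Let $s\in\mathbb{N}$ have base-$p$ expansion $s=\lfloor a_{k_s}a_{k_s-1}\cdots a_0\rfloor_p$ with $a_{k_s}\ne0$. Then $\Sigma^s[c]$ has period $p^{\ell-t+k_s}$.
   Context: $P_{p^\ell}$ is the module of periodic sequences $\mathbb{N}\to\mathbb{Z}_{p^\ell}$, and the period is the least $j\ge1$ with $f(n+j)=f(n)$ for all $n$. $[c]$ is the constant sequence with value $c$. $\Sigma$ is the sum operator $\Sigma f(0)=0$, $\Sigma f(n)=f(n-1)+\Sigma f(n-1)$. For a non-zero class $c\in\mathbb{Z}_{p^\ell}$, $\nu_p(c)$ is the $p$-adic valuation of any representative. $\lfloor a_k\cdots a_0\rfloor_p=\sum_ia_ip^i$ with digits $0\le a_i<p$. -}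

module Defs where

open import Data.Nat using (ℕ; zero; suc; _+_; _*_; _^_; _≤_; _<_; NonZero)
open import Data.Nat.DivMod using (_%_)
open import Relation.Binary.PropositionalEquality using (_≡_)
open import Relation.Nullary using (¬_)
open import Data.Nat.Divisibility using (_∣_)
open import Data.Product using (_×_)

-- Sequences ℕ → ℤ_m are represented by ℕ-valued functions read modulo m.
Seq : Set
Seq = ℕ → ℕ

const[_] : ℕ → Seq
const[ c ] _ = c

Σ : Seq → Seq
Σ f zero = 0
Σ f (suc n) = f n + Σ f n

Σ^ : ℕ → Seq → Seq
Σ^ zero f = f
Σ^ (suc s) f = Σ (Σ^ s f)

IsPeriodOf : (m : ℕ) .{{_ : NonZero m}} → Seq → ℕ → Set
IsPeriodOf m f j = (n : ℕ) → f (n + j) % m ≡ f n % m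

HasPeriod : (m : ℕ) .{{_ : NonZero m}} → Seq → ℕ → Set
HasPeriod m f j =
  (1 ≤ j) × IsPeriodOf m f j × ((i : ℕ) → 1 ≤ i → IsPeriodOf m f i → j ≤ i)

Valuation : ℕ → ℕ → ℕ → Set
Valuation p c t = (p ^ t ∣ c) × ¬ (p ^ suc t ∣ c)

digitsValue : ℕ → (ℕ → ℕ) → ℕ → ℕ
digitsValue p a zero = a 0
digitsValue p a (suc k) = a (suc k) * p ^ suc k + digitsValue p a k

BaseExpansion : ℕ → ℕ → (ℕ → ℕ) → ℕ → Set
BaseExpansion p s a k =
  ((i : ℕ) → i ≤ k → a i < p) × ¬ (a k ≡ 0) × (s ≡ digitsValue p a k)

-- Σ^s[c] n = c · C(n, s).  Modulo M, the periods of Σg are the periods j of g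
-- with M ∣ Σg(j), and for a period P of g one has Σg(qP) ≡ q·Σg(P); so if the
-- periods of g are the multiples of P, those of Σg are the multiples qP with
-- M ∣ q·Σg(P).  For g = Σ^s[c], M = p^ℓ and P = p^(ℓ-t+k) this condition reads
-- p^(ℓ-t) ∣ q·C(P, s+1).  From (s+1)·C(P, s+1) = P·C(P-1, s) and p ∤ C(P-1, s)
-- it always holds, except when s+1 = p^(k+1), where it amounts to p ∣ q.  By
-- induction on s, the period is thus multiplied by p exactly when s+1 reaches
-- the next power of p.

module Submission where

open import Defs
open import Data.Nat using (ℕ; zero; suc; pred; _+_; _*_; _^_; _≤_; _<_; _∸_; NonZero; z≤n; s≤s; z<s; s<s; _≤?_; >-nonZero; ≢-nonZero; nonTrivial⇒n>1)
open import Data.Nat.Properties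
open import Data.Nat.DivMod using (_%_; %-distribˡ-+; [m+n]%n≡m%n; m%n%n≡m%n; m%n<n; %-remove-+ˡ)
open import Data.Nat.Divisibility
open import Data.Nat.Primality using (Prime; euclidsLemma; prime⇒nonZero; prime⇒nonTrivial)
open import Data.Nat.Combinatorics using (_C_; nCk≡nC[n∸k]; nCn≡1; nC1≡n; k>n⇒nCk≡0; nCk+nC[k+1]≡[n+1]C[k+1])
open import Data.Nat.Tactic.RingSolver using (solve-∀)
import Algebra.Properties.CommutativeSemigroup
open import Data.Product using (_×_; _,_)
open import Data.Sum using (inj₁; inj₂)
open import Data.Empty using (⊥-elim)
open import Function using (_⇔_; mk⇔; Equivalence)
open import Function.Properties.Equivalence using () renaming (trans to ⇔-trans)
open import Relation.Binary.PropositionalEquality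
open import Relation.Nullary using (¬_; yes; no)

module +-CS = Algebra.Properties.CommutativeSemigroup +-commutativeSemigroup
module *-CS = Algebra.Properties.CommutativeSemigroup *-commutativeSemigroup

module Periodicity (M : ℕ) .{{_ : NonZero M}} where

  open ≡-Reasoning

  +-cong-% : ∀ {x y u v} → x % M ≡ y % M → u % M ≡ v % M → (x + u) % M ≡ (y + v) % M
  +-cong-% {x} {y} {u} {v} x≡y u≡v = begin
    (x + u) % M          ≡⟨ %-distribˡ-+ x u M ⟩
    (x % M + u % M) % M  ≡⟨ cong₂ (λ a b → (a + b) % M) x≡y u≡v ⟩
    (y % M + v % M) % M  ≡⟨ %-distribˡ-+ y v M ⟨
    (y + v) % M          ∎

  -- Adding M ∸ (z % M) undoes adding z.
  +-cancelʳ-% : ∀ {x y} z → (x + z) % M ≡ (y + z) % M → x % M ≡ y % M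
  +-cancelʳ-% {x} {y} z x+z≡y+z = begin
    x % M                            ≡⟨ complete x ⟨
    (x + z % M + (M ∸ z % M)) % M    ≡⟨ +-cong-% x+r≡y+r refl ⟩
    (y + z % M + (M ∸ z % M)) % M    ≡⟨ complete y ⟩
    y % M                            ∎
    where
    reduce : ∀ w → (w + z % M) % M ≡ (w + z) % M
    reduce w = +-cong-% refl (m%n%n≡m%n z M)

    x+r≡y+r : (x + z % M) % M ≡ (y + z % M) % M
    x+r≡y+r = trans (reduce x) (trans x+z≡y+z (sym (reduce y)))

    complete : ∀ w → (w + z % M + (M ∸ z % M)) % M ≡ w % M
    complete w = begin
      (w + z % M + (M ∸ z % M)) % M  ≡⟨ cong (_% M) (+-assoc w (z % M) (M ∸ z % M)) ⟩
      (w + (z % M + (M ∸ z % M))) % M ≡⟨ cong (λ e → (w + e) % M) (m+[n∸m]≡n (<⇒≤ (m%n<n z M))) ⟩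
      (w + M) % M                    ≡⟨ [m+n]%n≡m%n w M ⟩
      w % M                          ∎

  ∣-resp-% : ∀ {x y} → x % M ≡ y % M → M ∣ x → M ∣ y
  ∣-resp-% {x} {y} x≡y M∣x = m%n≡0⇒n∣m y M (trans (sym x≡y) (n∣m⇒m%n≡0 x M M∣x))

  Σ-shift : ∀ h L n → Σ h (n + L) ≡ Σ h L + Σ (λ i → h (i + L)) n
  Σ-shift h L zero = sym (+-identityʳ (Σ h L))
  Σ-shift h L (suc n) = begin
    h (n + L) + Σ h (n + L)                          ≡⟨ cong (h (n + L) +_) (Σ-shift h L n) ⟩
    h (n + L) + (Σ h L + Σ (λ i → h (i + L)) n)      ≡⟨ +-CS.x∙yz≈y∙xz (h (n + L)) (Σ h L) _ ⟩
    Σ h L + (h (n + L) + Σ (λ i → h (i + L)) n)      ∎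

  Σ-cong-% : ∀ {f g} → (∀ i → f i % M ≡ g i % M) → ∀ n → Σ f n % M ≡ Σ g n % M
  Σ-cong-% f≡g zero = refl
  Σ-cong-% f≡g (suc n) = +-cong-% (f≡g n) (Σ-cong-% f≡g n)

  Σ-isPeriodOf⇔ : ∀ g j → IsPeriodOf M (Σ g) j ⇔ (IsPeriodOf M g j × M ∣ Σ g j)
  Σ-isPeriodOf⇔ g j = mk⇔ to from
    where
    to : IsPeriodOf M (Σ g) j → IsPeriodOf M g j × M ∣ Σ g j
    to per = (λ n → +-cancelʳ-% (Σ g n) (trans (+-cong-% refl (sym (per n))) (per (suc n))))
           , ∣-resp-% (sym (per 0)) (M ∣0)

    from : IsPeriodOf M g j × M ∣ Σ g j → IsPeriodOf M (Σ g) j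
    from (per , M∣Σgj) n = begin
      Σ g (n + j) % M                           ≡⟨ cong (_% M) (Σ-shift g j n) ⟩
      (Σ g j + Σ (λ i → g (i + j)) n) % M       ≡⟨ %-remove-+ˡ _ M∣Σgj ⟩
      Σ (λ i → g (i + j)) n % M                 ≡⟨ Σ-cong-% per n ⟩
      Σ g n % M                                 ∎

  Σ[qL]≡qΣ[L] : ∀ {g L} → IsPeriodOf M g L → ∀ q → Σ g (q * L) % M ≡ (q * Σ g L) % M
  Σ[qL]≡qΣ[L] per zero = refl
  Σ[qL]≡qΣ[L] {g} {L} per (suc q) = begin
    Σ g (L + q * L) % M                         ≡⟨ cong (λ n → Σ g n % M) (+-comm L (q * L)) ⟩
    Σ g (q * L + L) % M                         ≡⟨ cong (_% M) (Σ-shift g L (q * L)) ⟩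
    (Σ g L + Σ (λ i → g (i + L)) (q * L)) % M   ≡⟨ +-cong-% refl (Σ-cong-% per (q * L)) ⟩
    (Σ g L + Σ g (q * L)) % M                   ≡⟨ +-cong-% refl (Σ[qL]≡qΣ[L] per q) ⟩
    (Σ g L + q * Σ g L) % M                     ∎

  PeriodsAreMultiplesOf : Seq → ℕ → Set
  PeriodsAreMultiplesOf f P = ∀ j → IsPeriodOf M f j ⇔ P ∣ j

  Σ-periodsAreMultiplesOf : ∀ {g P} D → PeriodsAreMultiplesOf g P →
    (∀ q → M ∣ q * Σ g P ⇔ D ∣ q) → PeriodsAreMultiplesOf (Σ g) (D * P)
  Σ-periodsAreMultiplesOf {g} {P} D periods condition j = mk⇔ to from
    where
    per-P : IsPeriodOf M g P
    per-P = Equivalence.from (periods P) ∣-refl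

    M∣Σg[qP]⇔M∣qΣgP : ∀ q → M ∣ Σ g (q * P) ⇔ M ∣ q * Σ g P
    M∣Σg[qP]⇔M∣qΣgP q = mk⇔ (∣-resp-% (Σ[qL]≡qΣ[L] per-P q)) (∣-resp-% (sym (Σ[qL]≡qΣ[L] per-P q)))

    to : IsPeriodOf M (Σ g) j → D * P ∣ j
    to per with Equivalence.to (Σ-isPeriodOf⇔ g j) per
    ... | per-g , M∣Σgj with Equivalence.to (periods j) per-g
    ... | divides q refl = *-monoˡ-∣ P (Equivalence.to (condition q) (Equivalence.to (M∣Σg[qP]⇔M∣qΣgP q) M∣Σgj))

    from : D * P ∣ j → IsPeriodOf M (Σ g) j
    from (divides d refl) = Equivalence.from (Σ-isPeriodOf⇔ g j) (per-g , M∣Σgj)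
      where
      j≡[dD]P : d * (D * P) ≡ d * D * P
      j≡[dD]P = sym (*-assoc d D P)
      per-g : IsPeriodOf M g (d * (D * P))
      per-g = Equivalence.from (periods _) (∣n⇒∣m*n d (n∣m*n D))
      M∣Σgj : M ∣ Σ g (d * (D * P))
      M∣Σgj = subst (λ n → M ∣ Σ g n) (sym j≡[dD]P)
        (Equivalence.from (M∣Σg[qP]⇔M∣qΣgP (d * D)) (Equivalence.from (condition (d * D)) (n∣m*n d)))

  periodsAreMultiplesOf⇒hasPeriod : ∀ {f P} → 1 ≤ P → PeriodsAreMultiplesOf f P → HasPeriod M f P
  periodsAreMultiplesOf⇒hasPeriod {P = P} 1≤P periods =
      1≤P
    , Equivalence.from (periods P) ∣-refl
    , λ i 1≤i per-i → ∣⇒≤ {{>-nonZero 1≤i}} (Equivalence.to (periods i) per-i)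

nC0≡1 : ∀ n → n C 0 ≡ 1
nC0≡1 n = trans (nCk≡nC[n∸k] {n = n} z≤n) (nCn≡1 n)

Σ^-const≡*C : ∀ c s n → Σ^ s const[ c ] n ≡ c * (n C s)
Σ^-const≡*C c zero n = sym (trans (cong (c *_) (nC0≡1 n)) (*-identityʳ c))
Σ^-const≡*C c (suc s) zero = sym (trans (cong (c *_) (k>n⇒nCk≡0 {0} {suc s} z<s)) (*-zeroʳ c))
Σ^-const≡*C c (suc s) (suc n) = begin
  Σ^ s const[ c ] n + Σ^ (suc s) const[ c ] n  ≡⟨ cong₂ _+_ (Σ^-const≡*C c s n) (Σ^-const≡*C c (suc s) n) ⟩
  c * (n C s) + c * (n C suc s)                ≡⟨ *-distribˡ-+ c (n C s) (n C suc s) ⟨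
  c * (n C s + n C suc s)                      ≡⟨ cong (c *_) (nCk+nC[k+1]≡[n+1]C[k+1] n s) ⟩
  c * (suc n C suc s)                          ∎
  where open ≡-Reasoning

k*nCk≡n*[n-1]C[k-1] : ∀ n k .{{_ : NonZero n}} .{{_ : NonZero k}} → k * (n C k) ≡ n * (pred n C pred k)
k*nCk≡n*[n-1]C[k-1] 1 1 = refl
k*nCk≡n*[n-1]C[k-1] 1 (suc (suc k)) = begin
  (2 + k) * (1 C (2 + k))  ≡⟨ cong ((2 + k) *_) (k>n⇒nCk≡0 {1} {2 + k} (s<s z<s)) ⟩
  (2 + k) * 0              ≡⟨ *-zeroʳ (2 + k) ⟩
  0                        ≡⟨ k>n⇒nCk≡0 {0} {suc k} z<s ⟨
  0 C suc k                ≡⟨ +-identityʳ (0 C suc k) ⟨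
  1 * (0 C suc k)          ∎
  where open ≡-Reasoning
k*nCk≡n*[n-1]C[k-1] (suc (suc n)) 1 = begin
  1 * ((2 + n) C 1)        ≡⟨ *-identityˡ ((2 + n) C 1) ⟩
  (2 + n) C 1              ≡⟨ nC1≡n (2 + n) ⟩
  2 + n                    ≡⟨ *-identityʳ (2 + n) ⟨
  (2 + n) * 1              ≡⟨ cong ((2 + n) *_) (nC0≡1 (suc n)) ⟨
  (2 + n) * (suc n C 0)    ∎
  where open ≡-Reasoning
k*nCk≡n*[n-1]C[k-1] (suc (suc n)) (suc (suc k)) = begin
  (2 + k) * ((2 + n) C (2 + k))              ≡⟨ cong ((2 + k) *_) (nCk+nC[k+1]≡[n+1]C[k+1] (suc n) (suc k)) ⟨
  (2 + k) * (X + Y)                          ≡⟨ split k X Y ⟩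
  X + (suc k * X + (2 + k) * Y)              ≡⟨ cong₂ (λ u v → X + (u + v)) (k*nCk≡n*[n-1]C[k-1] (suc n) (suc k))
                                                                            (k*nCk≡n*[n-1]C[k-1] (suc n) (2 + k)) ⟩
  X + (suc n * a + suc n * b)                ≡⟨ cong (_+ (suc n * a + suc n * b)) (nCk+nC[k+1]≡[n+1]C[k+1] n k) ⟨
  a + b + (suc n * a + suc n * b)            ≡⟨ merge n a b ⟩
  (2 + n) * (a + b)                          ≡⟨ cong ((2 + n) *_) (nCk+nC[k+1]≡[n+1]C[k+1] n k) ⟩
  (2 + n) * X                                ∎
  where
  open ≡-Reasoning
  X Y a b : ℕ
  X = suc n C suc k
  Y = suc n C (2 + k)
  a = n C k
  b = n C suc k
  split : ∀ k X Y → (2 + k) * (X + Y) ≡ X + ((1 + k) * X + (2 + k) * Y)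
  split = solve-∀
  merge : ∀ n a b → a + b + ((1 + n) * a + (1 + n) * b) ≡ (2 + n) * (a + b)
  merge = solve-∀

module PrimePowers {p : ℕ} (p-prime : Prime p) where

  instance
    p≢0 : NonZero p
    p≢0 = prime⇒nonZero p-prime

  1<p : 1 < p
  1<p = nonTrivial⇒n>1 p {{prime⇒nonTrivial p-prime}}

  pᵃ∣pᵃ⁺ᵇ : ∀ a b → p ^ a ∣ p ^ (a + b)
  pᵃ∣pᵃ⁺ᵇ a b = subst (p ^ a ∣_) (sym (^-distribˡ-+-* p a b)) (m∣m*n (p ^ b))

  pᵃ∣rx∧p∤r⇒pᵃ∣x : ∀ a {r x} → p ^ a ∣ r * x → ¬ p ∣ r → p ^ a ∣ x
  pᵃ∣rx∧p∤r⇒pᵃ∣x zero _ _ = 1∣ _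
  pᵃ∣rx∧p∤r⇒pᵃ∣x (suc a) {r} pᵃ⁺¹∣rx p∤r
    with pᵃ∣rx∧p∤r⇒pᵃ∣x a (∣-trans (n∣m*n p) pᵃ⁺¹∣rx) p∤r
  ... | divides x′ refl = *-monoˡ-∣ (p ^ a) p∣x′
    where
    p∣rx′ : p ∣ r * x′
    p∣rx′ = *-cancelʳ-∣ (p ^ a) {{m^n≢0 p a}} (subst (p * p ^ a ∣_) (sym (*-assoc r x′ (p ^ a))) pᵃ⁺¹∣rx)
    p∣x′ : p ∣ x′
    p∣x′ with euclidsLemma r x′ p-prime p∣rx′
    ... | inj₁ p∣r = ⊥-elim (p∤r p∣r)
    ... | inj₂ p∣x′ = p∣x′

  pᵃ⁺ᵏ∣rx∧pᵏ⁺¹∤r⇒pᵃ∣x : ∀ a k {r x} → p ^ (a + k) ∣ r * x → ¬ p ^ suc k ∣ r → p ^ a ∣ x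
  pᵃ⁺ᵏ∣rx∧pᵏ⁺¹∤r⇒pᵃ∣x a zero {r} {x} pᵃ∣rx p¹∤r =
    pᵃ∣rx∧p∤r⇒pᵃ∣x a (subst (λ e → p ^ e ∣ r * x) (+-identityʳ a) pᵃ∣rx)
      (λ p∣r → p¹∤r (subst (_∣ r) (sym (*-identityʳ p)) p∣r))
  pᵃ⁺ᵏ∣rx∧pᵏ⁺¹∤r⇒pᵃ∣x a (suc k) {r} {x} pᵃ⁺ᵏ∣rx pᵏ⁺¹∤r with p ∣? r
  ... | no p∤r = ∣-trans (pᵃ∣pᵃ⁺ᵇ a (suc k)) (pᵃ∣rx∧p∤r⇒pᵃ∣x (a + suc k) pᵃ⁺ᵏ∣rx p∤r)
  ... | yes (divides r′ refl) = pᵃ⁺ᵏ∣rx∧pᵏ⁺¹∤r⇒pᵃ∣x a k pᵃ⁺ᵏ∣r′x pᵏ⁺¹∤r′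
    where
    pᵃ⁺ᵏ∣r′x : p ^ (a + k) ∣ r′ * x
    pᵃ⁺ᵏ∣r′x = *-cancelˡ-∣ p (subst₂ _∣_ (cong (p ^_) (+-suc a k)) (*-CS.xy∙z≈y∙xz r′ p x) pᵃ⁺ᵏ∣rx)
    pᵏ⁺¹∤r′ : ¬ p ^ suc k ∣ r′
    pᵏ⁺¹∤r′ pᵏ⁺¹∣r′ = pᵏ⁺¹∤r (subst (p ^ suc (suc k) ∣_) (*-comm p r′) (*-monoʳ-∣ p pᵏ⁺¹∣r′))

  pᵗ⁺ᵐ∣cy⇔pᵐ∣y : ∀ {c} t m {y} → Valuation p c t → p ^ (t + m) ∣ c * y ⇔ p ^ m ∣ y
  pᵗ⁺ᵐ∣cy⇔pᵐ∣y t m {y} (divides u refl , pᵗ⁺¹∤c) = mk⇔ to from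
    where
    p∤u : ¬ p ∣ u
    p∤u p∣u = pᵗ⁺¹∤c (*-monoˡ-∣ (p ^ t) p∣u)
    pᵗ⁺ᵐ≡ : p ^ (t + m) ≡ p ^ t * p ^ m
    pᵗ⁺ᵐ≡ = ^-distribˡ-+-* p t m
    cy≡ : u * p ^ t * y ≡ p ^ t * (u * y)
    cy≡ = *-CS.xy∙z≈y∙xz u (p ^ t) y
    to : p ^ (t + m) ∣ u * p ^ t * y → p ^ m ∣ y
    to h = pᵃ∣rx∧p∤r⇒pᵃ∣x m (*-cancelˡ-∣ (p ^ t) {{m^n≢0 p t}} (subst₂ _∣_ pᵗ⁺ᵐ≡ cy≡ h)) p∤u
    from : p ^ m ∣ y → p ^ (t + m) ∣ u * p ^ t * y
    from h = subst₂ _∣_ (sym pᵗ⁺ᵐ≡) (sym cy≡) (*-monoʳ-∣ (p ^ t) (∣n⇒∣m*n u h))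

  p∤[pᴺ-1]Cr : ∀ N r → r < p ^ N → ¬ p ∣ pred (p ^ N) C r
  p∤[pᴺ-1]Cr N zero _ p∣1 = <⇒≢ 1<p (sym (∣1⇒≡1 (subst (p ∣_) (nC0≡1 (pred (p ^ N))) p∣1)))
  p∤[pᴺ-1]Cr zero (suc r) (s<s ())
  p∤[pᴺ-1]Cr (suc N) (suc r) r+1<pᴺ p∣wCr+1 = p∤[pᴺ-1]Cr (suc N) r (<-trans (n<1+n r) r+1<pᴺ) p∣wCr
    where
    instance
      pᴺ≢0 : NonZero (p ^ suc N)
      pᴺ≢0 = m^n≢0 p (suc N)
    w : ℕ
    w = pred (p ^ suc N)
    -- (r+1) C(p^N, r+1) = p^N C(w, r), while p^N ∤ r+1
    p∣pᴺCr+1 : p ∣ p ^ suc N C suc r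
    p∣pᴺCr+1 = subst (_∣ p ^ suc N C suc r) (*-identityʳ p)
      (pᵃ⁺ᵏ∣rx∧pᵏ⁺¹∤r⇒pᵃ∣x 1 N
        (subst (p ^ suc N ∣_) (sym (k*nCk≡n*[n-1]C[k-1] (p ^ suc N) (suc r))) (m∣m*n (w C r)))
        (>⇒∤ r+1<pᴺ))
    pascal : w C suc r + w C r ≡ p ^ suc N C suc r
    pascal = trans (+-comm (w C suc r) (w C r))
      (trans (nCk+nC[k+1]≡[n+1]C[k+1] w r) (cong (_C suc r) (suc-pred (p ^ suc N))))
    p∣wCr : p ∣ w C r
    p∣wCr = ∣m+n∣m⇒∣n (subst (p ∣_) (sym pascal) p∣pᴺCr+1) p∣wCr+1

  pᵐ∣pᵐ⁺ᵏCr : ∀ m k r .{{_ : NonZero r}} → r < p ^ suc k → p ^ m ∣ p ^ (m + k) C r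
  pᵐ∣pᵐ⁺ᵏCr m k r r<pᵏ⁺¹ = pᵃ⁺ᵏ∣rx∧pᵏ⁺¹∤r⇒pᵃ∣x m k
    (subst (p ^ (m + k) ∣_) (sym (k*nCk≡n*[n-1]C[k-1] (p ^ (m + k)) r {{m^n≢0 p (m + k)}})) (m∣m*n _))
    (>⇒∤ r<pᵏ⁺¹)

  pX≡pᵐY∧p∤Y⇒[pᵐ∣qX⇔p∣q] : ∀ m {X Y} → p * X ≡ p ^ m * Y → ¬ p ∣ Y → ∀ q → p ^ m ∣ q * X ⇔ p ∣ q
  pX≡pᵐY∧p∤Y⇒[pᵐ∣qX⇔p∣q] m {X} {Y} pX≡pᵐY p∤Y q = mk⇔ to from
    where
    p[qX]≡pᵐ[qY] : p * (q * X) ≡ p ^ m * (q * Y)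
    p[qX]≡pᵐ[qY] = trans (*-CS.x∙yz≈y∙xz p q X) (trans (cong (q *_) pX≡pᵐY) (*-CS.x∙yz≈y∙xz q (p ^ m) Y))

    pᵐ∣qX⇒p∣qY : p ^ m ∣ q * X → p ∣ q * Y
    pᵐ∣qX⇒p∣qY pᵐ∣qX = *-cancelˡ-∣ (p ^ m) {{m^n≢0 p m}}
      (subst₂ _∣_ (*-comm p (p ^ m)) p[qX]≡pᵐ[qY] (*-monoʳ-∣ p pᵐ∣qX))

    to : p ^ m ∣ q * X → p ∣ q
    to pᵐ∣qX with euclidsLemma q Y p-prime (pᵐ∣qX⇒p∣qY pᵐ∣qX)
    ... | inj₁ p∣q = p∣q
    ... | inj₂ p∣Y = ⊥-elim (p∤Y p∣Y)

    from : p ∣ q → p ^ m ∣ q * X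
    from (divides q′ refl) = subst (p ^ m ∣_) (trans (cong (q′ *_) (sym pX≡pᵐY)) (sym (*-assoc q′ p X)))
      (∣n⇒∣m*n q′ (m∣m*n Y))

  pᵐ∣q*pᵐ⁺ᵏCpᵏ⁺¹⇔p∣q : ∀ {m} k q → 1 ≤ m → p ^ m ∣ q * (p ^ (m + k) C p ^ suc k) ⇔ p ∣ q
  pᵐ∣q*pᵐ⁺ᵏCpᵏ⁺¹⇔p∣q {m} k q 1≤m = pX≡pᵐY∧p∤Y⇒[pᵐ∣qX⇔p∣q] m pX≡pᵐC′ p∤C′ q
    where
    instance
      pᵏ≢0 : NonZero (p ^ k)
      pᵏ≢0 = m^n≢0 p k
      pᵏ⁺¹≢0 : NonZero (p ^ suc k)
      pᵏ⁺¹≢0 = m^n≢0 p (suc k)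
      pᴺ≢0 : NonZero (p ^ (m + k))
      pᴺ≢0 = m^n≢0 p (m + k)
    X C′ : ℕ
    X = p ^ (m + k) C p ^ suc k
    C′ = pred (p ^ (m + k)) C pred (p ^ suc k)

    pX≡pᵐC′ : p * X ≡ p ^ m * C′
    pX≡pᵐC′ = *-cancelˡ-≡ (p * X) (p ^ m * C′) (p ^ k) (begin
      p ^ k * (p * X)        ≡⟨ *-CS.x∙yz≈yx∙z (p ^ k) p X ⟩
      p ^ suc k * X          ≡⟨ k*nCk≡n*[n-1]C[k-1] (p ^ (m + k)) (p ^ suc k) ⟩
      p ^ (m + k) * C′       ≡⟨ cong (_* C′) (^-distribˡ-+-* p m k) ⟩
      p ^ m * p ^ k * C′     ≡⟨ *-CS.xy∙z≈y∙xz (p ^ m) (p ^ k) C′ ⟩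
      p ^ k * (p ^ m * C′)   ∎)
      where open ≡-Reasoning

    p∤C′ : ¬ p ∣ C′
    p∤C′ = p∤[pᴺ-1]Cr (m + k) (pred (p ^ suc k))
      (<-≤-trans (m≤pred[n]⇒suc[m]≤n ≤-refl) (^-monoʳ-≤ p (+-monoˡ-≤ k 1≤m)))

pᵏ≤digitsValue : ∀ p a k → ¬ a k ≡ 0 → p ^ k ≤ digitsValue p a k
pᵏ≤digitsValue p a zero a₀≢0 = n≢0⇒n>0 a₀≢0
pᵏ≤digitsValue p a (suc k) aₖ≢0 =
  ≤-trans (m≤n*m (p ^ suc k) (a (suc k)) {{≢-nonZero aₖ≢0}}) (m≤m+n _ (digitsValue p a k))

digitsValue<pᵏ⁺¹ : ∀ p a k → (∀ i → i ≤ k → a i < p) → digitsValue p a k < p ^ suc k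
digitsValue<pᵏ⁺¹ p a zero digits<p = subst (a 0 <_) (sym (*-identityʳ p)) (digits<p 0 z≤n)
digitsValue<pᵏ⁺¹ p a (suc k) digits<p = begin-strict
  a (suc k) * P + digitsValue p a k   <⟨ +-monoʳ-< (a (suc k) * P) (digitsValue<pᵏ⁺¹ p a k (λ i i≤k → digits<p i (m≤n⇒m≤1+n i≤k))) ⟩
  a (suc k) * P + P                   ≡⟨ +-comm (a (suc k) * P) P ⟩
  suc (a (suc k)) * P                 ≤⟨ *-monoˡ-≤ P (digits<p (suc k) ≤-refl) ⟩
  p * P                               ∎
  where
  open ≤-Reasoning
  P : ℕ
  P = p ^ suc k

module IteratedSums {p : ℕ} (p-prime : Prime p) {ℓ t m c : ℕ} .{{_ : NonZero (p ^ ℓ)}}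
  (ℓ≡t+m : ℓ ≡ t + m) (1≤m : 1 ≤ m) (val : Valuation p c t) where

  open PrimePowers p-prime
  open Periodicity (p ^ ℓ)

  pˡ∣q*Σ^[1+s]⇔pᵐ∣q*nC[1+s] : ∀ s n q → p ^ ℓ ∣ q * Σ^ (suc s) const[ c ] n ⇔ p ^ m ∣ q * (n C suc s)
  pˡ∣q*Σ^[1+s]⇔pᵐ∣q*nC[1+s] s n q = mk⇔
    (λ h → Equivalence.to (pᵗ⁺ᵐ∣cy⇔pᵐ∣y t m val) (subst₂ _∣_ (cong (p ^_) ℓ≡t+m) q*Σ^≡c*[q*C] h))
    (λ h → subst₂ _∣_ (cong (p ^_) (sym ℓ≡t+m)) (sym q*Σ^≡c*[q*C]) (Equivalence.from (pᵗ⁺ᵐ∣cy⇔pᵐ∣y t m val) h))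
    where
    q*Σ^≡c*[q*C] : q * Σ^ (suc s) const[ c ] n ≡ c * (q * (n C suc s))
    q*Σ^≡c*[q*C] = trans (cong (q *_) (Σ^-const≡*C c (suc s) n)) (*-CS.x∙yz≈y∙xz q c (n C suc s))

  periods-Σ¹ : PeriodsAreMultiplesOf (Σ^ 1 const[ c ]) (p ^ (m + 0))
  periods-Σ¹ = subst (PeriodsAreMultiplesOf (Σ^ 1 const[ c ]))
    (trans (*-identityʳ (p ^ m)) (cong (p ^_) (sym (+-identityʳ m))))
    (Σ-periodsAreMultiplesOf (p ^ m) periods-const condition)
    where
    periods-const : PeriodsAreMultiplesOf const[ c ] 1
    periods-const j = mk⇔ (λ _ → 1∣ j) (λ _ _ → refl)
    condition : ∀ q → p ^ ℓ ∣ q * Σ const[ c ] 1 ⇔ p ^ m ∣ q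
    condition q = subst (λ x → p ^ ℓ ∣ q * Σ const[ c ] 1 ⇔ p ^ m ∣ x) (*-identityʳ q)
      (pˡ∣q*Σ^[1+s]⇔pᵐ∣q*nC[1+s] 0 1 q)

  periods-Σ-nonpower : ∀ {s k} → PeriodsAreMultiplesOf (Σ^ s const[ c ]) (p ^ (m + k)) →
    suc s < p ^ suc k → PeriodsAreMultiplesOf (Σ^ (suc s) const[ c ]) (p ^ (m + k))
  periods-Σ-nonpower {s} {k} periods s+1<pᵏ⁺¹ = subst (PeriodsAreMultiplesOf (Σ^ (suc s) const[ c ]))
    (*-identityˡ (p ^ (m + k)))
    (Σ-periodsAreMultiplesOf 1 periods (λ q → mk⇔ (λ _ → 1∣ q) (λ _ → pˡ∣q*Σ q)))
    where
    pˡ∣q*Σ : ∀ q → p ^ ℓ ∣ q * Σ^ (suc s) const[ c ] (p ^ (m + k))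
    pˡ∣q*Σ q = Equivalence.from (pˡ∣q*Σ^[1+s]⇔pᵐ∣q*nC[1+s] s (p ^ (m + k)) q)
      (∣n⇒∣m*n q (pᵐ∣pᵐ⁺ᵏCr m k (suc s) s+1<pᵏ⁺¹))

  periods-Σ-power : ∀ {s k} → PeriodsAreMultiplesOf (Σ^ s const[ c ]) (p ^ (m + k)) →
    suc s ≡ p ^ suc k → PeriodsAreMultiplesOf (Σ^ (suc s) const[ c ]) (p ^ (m + suc k))
  periods-Σ-power {s} {k} periods s+1≡pᵏ⁺¹ = subst (PeriodsAreMultiplesOf (Σ^ (suc s) const[ c ]))
    (cong (p ^_) (sym (+-suc m k)))
    (Σ-periodsAreMultiplesOf p periods condition)
    where
    condition : ∀ q → p ^ ℓ ∣ q * Σ^ (suc s) const[ c ] (p ^ (m + k)) ⇔ p ∣ q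
    condition q = ⇔-trans (pˡ∣q*Σ^[1+s]⇔pᵐ∣q*nC[1+s] s (p ^ (m + k)) q)
      (subst (λ r → p ^ m ∣ q * (p ^ (m + k) C r) ⇔ p ∣ q) (sym s+1≡pᵏ⁺¹) (pᵐ∣q*pᵐ⁺ᵏCpᵏ⁺¹⇔p∣q k q 1≤m))

  periods-Σ-next : ∀ {s k} →
    (∀ k′ → p ^ k′ ≤ suc s → suc s < p ^ suc k′ → PeriodsAreMultiplesOf (Σ^ (suc s) const[ c ]) (p ^ (m + k′))) →
    p ^ k ≤ suc (suc s) → suc (suc s) < p ^ suc k → PeriodsAreMultiplesOf (Σ^ (suc (suc s)) const[ c ]) (p ^ (m + k))
  periods-Σ-next {s} {zero} periods _ s+2<p =
    periods-Σ-nonpower (periods zero (s≤s z≤n) (<-trans (n<1+n _) s+2<p)) s+2<p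
  periods-Σ-next {s} {suc k′} periods pᵏ≤s+2 s+2<pᵏ⁺¹ with p ^ suc k′ ≤? suc s
  ... | yes pᵏ≤s+1 = periods-Σ-nonpower (periods (suc k′) pᵏ≤s+1 (<-trans (n<1+n _) s+2<pᵏ⁺¹)) s+2<pᵏ⁺¹
  ... | no pᵏ≰s+1 = periods-Σ-power (periods k′ pᵏ′≤s+1 s+1<pᵏ) s+2≡pᵏ
    where
    s+1<pᵏ : suc s < p ^ suc k′
    s+1<pᵏ = ≰⇒> pᵏ≰s+1
    s+2≡pᵏ : suc (suc s) ≡ p ^ suc k′
    s+2≡pᵏ = ≤-antisym s+1<pᵏ pᵏ≤s+2
    pᵏ′≤s+1 : p ^ k′ ≤ suc s
    pᵏ′≤s+1 = ≤-pred (subst (p ^ k′ <_) (sym s+2≡pᵏ) (^-monoʳ-< p 1<p (n<1+n k′)))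

  periods-Σ^ : ∀ s k → p ^ k ≤ s → s < p ^ suc k → PeriodsAreMultiplesOf (Σ^ s const[ c ]) (p ^ (m + k))
  periods-Σ^ 0 k pᵏ≤0 _ = ⊥-elim (<⇒≱ (m^n>0 p k) pᵏ≤0)
  periods-Σ^ 1 zero _ _ = periods-Σ¹
  periods-Σ^ 1 (suc k) pᵏ⁺¹≤1 _ = ⊥-elim (<⇒≱ 1<p (≤-trans (m≤m*n p (p ^ k) {{m^n≢0 p k}}) pᵏ⁺¹≤1))
  periods-Σ^ (suc (suc s)) k = periods-Σ-next (periods-Σ^ (suc s))

proposition3p4 : (p ℓ : ℕ) → Prime p → 1 ≤ ℓ → .{{_ : NonZero (p ^ ℓ)}} →
    (c : ℕ) → ¬ (p ^ ℓ ∣ c) → (t : ℕ) → Valuation p c t →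
    (s k : ℕ) → (a : ℕ → ℕ) → BaseExpansion p s a k →
    HasPeriod (p ^ ℓ) (Σ^ s const[ c ]) (p ^ (ℓ ∸ t + k))
proposition3p4 p ℓ p-prime _ c pˡ∤c t val@(pᵗ∣c , _) .(digitsValue p a k) k a (digits<p , aₖ≢0 , refl) =
  periodsAreMultiplesOf⇒hasPeriod (m^n>0 p (ℓ ∸ t + k))
    (periods-Σ^ (digitsValue p a k) k (pᵏ≤digitsValue p a k aₖ≢0) (digitsValue<pᵏ⁺¹ p a k digits<p))
  where
  open PrimePowers p-prime
  t<ℓ : t < ℓ
  t<ℓ = ≰⇒> (λ ℓ≤t → pˡ∤c (∣-trans (subst (λ e → p ^ ℓ ∣ p ^ e) (m+[n∸m]≡n ℓ≤t) (pᵃ∣pᵃ⁺ᵇ ℓ (t ∸ ℓ))) pᵗ∣c))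
  open IteratedSums p-prime (sym (m+[n∸m]≡n (<⇒≤ t<ℓ))) (m<n⇒0<n∸m t<ℓ) val
  open Periodicity (p ^ ℓ)
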